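{- Let $p(n)$ be the number of isomorphism classes of powerful sets of order $n$ and let $\ell(n)$ be the number of isomorphism classes of linear powerful sets of order $n$ (i.e. linear subspaces of $\mathbb{F}_2^n$). Then $\ell(n)/p(n)\to 0$ as $n\to\infty$; that is, asymptotically almost all powerful sets are nonlinear.
   Context: A set $S\subseteq\mathbb{F}_2^n$ (positions indexed by $[n]$; $n$ is its order) is a powerful set if for every $X\subseteq[n]$ the number of vectors in $S$ that are zero in all positions of $X$ is a power of $2$. Two such sets are isomorphic if some permutation of the coordinate positions maps one bijectively onto the other. -}

module Defs where

open import Data.Bool using (Bool; true; false; if_then_else_; _xor_)
open import Data.Nat using (ℕ; zero; suc; _+_; _^_)
open import Data.Fin using (Fin)
open import Data.Fin.Subset using (Subset; _∈_)
open import Data.Fin.Permutation using (Permutation′; _⟨$⟩ʳ_)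
open import Data.Vec using (Vec; []; _∷_; lookup; tabulate; replicate; zipWith)
open import Data.Product using (Σ; ∃; _×_)
open import Relation.Nullary using (¬_)
open import Relation.Binary.PropositionalEquality using (_≡_)

-- Vectors of F₂ⁿ : Bool with false = 0, true = 1, addition = xor.
F₂^ : ℕ → Set
F₂^ n = Vec Bool n

VSet : ℕ → Set
VSet n = F₂^ n → Bool

count : (n : ℕ) → (F₂^ n → Bool) → ℕ
count zero    P = if P [] then 1 else 0
count (suc n) P = count n (λ v → P (false ∷ v)) + count n (λ v → P (true ∷ v))

zeroOn : {n : ℕ} → Subset n → F₂^ n → Bool
zeroOn []            []      = true
zeroOn (false ∷ X)   (_ ∷ v) = zeroOn X v
zeroOn (true ∷ X)    (b ∷ v) = if b then false else zeroOn X v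

IsPowerOf2 : ℕ → Set
IsPowerOf2 m = ∃ λ k → m ≡ 2 ^ k

Powerful : {n : ℕ} → VSet n → Set
Powerful {n} S = (X : Subset n) → IsPowerOf2 (count n (λ v → if S v then zeroOn X v else false))

Linear : {n : ℕ} → VSet n → Set
Linear {n} S = (S (replicate n false) ≡ true)
             × ((u v : F₂^ n) → S u ≡ true → S v ≡ true → S (zipWith _xor_ u v) ≡ true)

permute : {n : ℕ} → Permutation′ n → F₂^ n → F₂^ n
permute π v = tabulate (λ i → lookup v (π ⟨$⟩ʳ i))

Isomorphic : {n : ℕ} → VSet n → VSet n → Set
Isomorphic S T = Σ (Permutation′ _) λ π → ∀ v → T (permute π v) ≡ S v

-- "The number of isomorphism classes of sets of order n satisfying P is k":
-- there are k pairwise non-isomorphic representatives satisfying P,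
-- and every set satisfying P is isomorphic to one of them.
NumIsoClasses : (P : {n : ℕ} → VSet n → Set) → ℕ → ℕ → Set
NumIsoClasses P n k =
  Σ (Fin k → VSet n) λ rep →
      ((i : Fin k) → P (rep i))
    × ((i j : Fin k) → Isomorphic (rep i) (rep j) → i ≡ j)
    × ((S : VSet n) → P S → ∃ λ i → Isomorphic S (rep i))

-- Powerful and linear (linear subspaces are automatically powerful).
LinearPowerful : {n : ℕ} → VSet n → Set
LinearPowerful S = Powerful S × Linear S

-- A linear subspace of F₂ⁿ is determined by its reduced echelon form, which is fixed by the
-- pivot positions and the free entries of the pivot rows: at most 2^(n + d(n − d)) ≤ 2^(n + n²/4)
-- forms of dimension d, so ℓ(n) ≤ (n + 1)·2^(n + n²/4).
-- Conversely, if A ⊆ B are linear then {0} × A ∪ {1} × (B ∖ A) is powerful: for a coordinate set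
-- X containing the new coordinate it meets the vectors vanishing on X in as many points as A does,
-- and for one avoiding it in as many as B does. Taking for B the graph of a linear map
-- F₂^2m → F₂^(m+r) and for A its part over the graph of a linear map F₂^m → F₂^m gives 2^(3m² + 2mr)
-- distinct powerful sets of order n = 3m + r + 1. An isomorphism class contains at most n^n of
-- them, so p(n) ≥ 2^(n²/3 − O(n)) / n^n, which eventually exceeds k·ℓ(n) for every k.
module Submission where

open import Algebra.Bundles using (CommutativeRing)
import Algebra.Properties.CommutativeSemigroup as CommutativeSemigroupProperties
open import Data.Bool using (Bool; true; false; if_then_else_; _xor_; _∧_; _≟_)
open import Data.Bool.Properties
  using (∧-identityʳ; ∧-zeroʳ; ∧-distribˡ-xor; xor-assoc; xor-same; xor-identityʳ; xor-∧-commutativeRing; if-eta; ⇔→≡)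
open import Data.Fin using (Fin; zero; combine; remQuot; funToFin; finToFun)
open import Data.Fin.Permutation using (Permutation′; _⟨$⟩ʳ_)
import Data.Fin.Permutation as Permutation
open import Data.Fin.Properties using (2↔Bool; combine-remQuot; combine-injective; finToFun-funToFin; injective⇒≤)
open import Data.Fin.Subset using (Subset)
open import Data.List using (List; []; _∷_)
import Data.List as List
open import Data.List.Membership.Propositional using (_∈_)
open import Data.List.Membership.Propositional.Properties using (∈-++⁺ˡ; ∈-++⁺ʳ; ∈-map⁺; ∈-concat⁺′; ∈-upTo⁺)
open import Data.List.Properties using (length-++; length-map; length-upTo)
open import Data.List.Relation.Unary.Any using (here)
open import Data.List.Relation.Unary.Any.Properties using (lookup-index)
open import Data.Nat using (ℕ; zero; suc; _+_; _*_; _^_; _∸_; _≤_; _<_; z≤n; s≤s; NonZero; >-nonZero)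
open import Data.Nat.DivMod using (_/_; _%_; m≡m%n+[m/n]*n; m%n<n; /-monoˡ-≤; m*n/n≡m; m/n*n≤m)
open import Data.Nat.Properties hiding (_≟_)
open import Data.Nat.Tactic.RingSolver using (solve-∀)
open import Data.Product using (Σ; ∃; _×_; _,_; proj₁; proj₂; uncurry)
open import Data.Sum using (_⊎_; inj₁; inj₂)
open import Data.Unit using (⊤; tt)
open import Data.Vec using (Vec; []; _∷_; replicate; zipWith; drop; lookup)
open import Data.Vec.Properties using (∷-injectiveˡ; ∷-injectiveʳ; ≡-dec; tabulate-cong; tabulate∘lookup)
open import Data.Vec.Relation.Binary.Pointwise.Inductive using (Pointwise-≡⇒≡; zipWith-assoc; zipWith-identityʳ)
open import Function.Base using (_∘_)
open import Function.Bundles using (Injection; _↣_; mk⇔)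
open import Function.Definitions using (Injective)
open import Function.Properties.Inverse using (↔⇒↣)
open import Relation.Binary.Definitions using (DecidableEquality)
open import Relation.Binary.PropositionalEquality
open import Relation.Nullary using (yes; does)
open import Relation.Nullary.Decidable using (dec-true)

open import Defs

open CommutativeSemigroupProperties +-commutativeSemigroup using () renaming (interchange to +-interchange)
open CommutativeSemigroupProperties *-commutativeSemigroup using () renaming (interchange to *-interchange)
open CommutativeSemigroupProperties (CommutativeRing.+-commutativeSemigroup xor-∧-commutativeRing)
  using () renaming (interchange to xor-interchange)

variable
  n m a b c d : ℕ

infixl 6 _⊕_
_⊕_ : F₂^ n → F₂^ n → F₂^ n
_⊕_ = zipWith _xor_

0ⁿ : F₂^ n
0ⁿ = replicate _ false

⊕-assoc : (u v w : F₂^ n) → (u ⊕ v) ⊕ w ≡ u ⊕ (v ⊕ w)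
⊕-assoc u v w = Pointwise-≡⇒≡ (zipWith-assoc xor-assoc u v w)

⊕-identityʳ : (u : F₂^ n) → u ⊕ 0ⁿ ≡ u
⊕-identityʳ u = Pointwise-≡⇒≡ (zipWith-identityʳ xor-identityʳ u)

⊕-same : (u : F₂^ n) → u ⊕ u ≡ 0ⁿ
⊕-same []      = refl
⊕-same (x ∷ u) = cong₂ _∷_ (xor-same x) (⊕-same u)

⊕-cancelʳ : (u v : F₂^ n) → (u ⊕ v) ⊕ v ≡ u
⊕-cancelʳ u v = begin
  (u ⊕ v) ⊕ v  ≡⟨ ⊕-assoc u v v ⟩
  u ⊕ (v ⊕ v)  ≡⟨ cong (u ⊕_) (⊕-same v) ⟩
  u ⊕ 0ⁿ       ≡⟨ ⊕-identityʳ u ⟩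
  u            ∎
  where open ≡-Reasoning

_≟ᵛ_ : DecidableEquality (F₂^ n)
_≟ᵛ_ = ≡-dec _≟_

full : VSet n
full _ = true

infixr 7 _∩_
_∩_ : VSet n → VSet n → VSet n
(S ∩ T) v = if S v then T v else false

infixl 7 _∖_
_∖_ : VSet n → VSet n → VSet n
(S ∖ T) v = if T v then false else S v

_⊆_ : VSet n → VSet n → Set
S ⊆ T = ∀ v → S v ≡ true → T v ≡ true

∩-true : (S T : VSet n) (v : F₂^ n) → (S ∩ T) v ≡ true → S v ≡ true × T v ≡ true
∩-true S T v S∩Tv with S v
... | true = refl , S∩Tv

count-cong : {P Q : F₂^ n → Bool} → P ≗ Q → count n P ≡ count n Q
count-cong {zero}          P≗Q rewrite P≗Q [] = refl
count-cong {suc n} {P} {Q} P≗Q =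
  cong₂ _+_ (count-cong {P = P ∘ (false ∷_)} {Q ∘ (false ∷_)} (P≗Q ∘ (false ∷_)))
            (count-cong {P = P ∘ (true ∷_)} {Q ∘ (true ∷_)} (P≗Q ∘ (true ∷_)))

count-empty : (P : F₂^ n → Bool) → (∀ v → P v ≡ false) → count n P ≡ 0
count-empty {zero}  P P≡false rewrite P≡false [] = refl
count-empty {suc n} P P≡false =
  cong₂ _+_ (count-empty _ (P≡false ∘ (false ∷_))) (count-empty _ (P≡false ∘ (true ∷_)))

count-split : (P Q : VSet n) → count n P ≡ count n (Q ∩ P) + count n (P ∖ Q)
count-split {zero} P Q with Q [] | P []
... | true  | true  = refl
... | true  | false = refl
... | false | true  = refl
... | false | false = refl
count-split {suc n} P Q =
  trans (cong₂ _+_ (count-split P₀ Q₀) (count-split P₁ Q₁))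
        (+-interchange (count n (Q₀ ∩ P₀)) (count n (P₀ ∖ Q₀)) (count n (Q₁ ∩ P₁)) (count n (P₁ ∖ Q₁)))
  where
  P₀ P₁ Q₀ Q₁ : VSet n
  P₀ = P ∘ (false ∷_)
  P₁ = P ∘ (true ∷_)
  Q₀ = Q ∘ (false ∷_)
  Q₁ = Q ∘ (true ∷_)

count-translate : (P : F₂^ n → Bool) (u : F₂^ n) → count n (λ v → P (v ⊕ u)) ≡ count n P
count-translate {zero}  P []          = refl
count-translate {suc n} P (false ∷ u) =
  cong₂ _+_ (count-translate (P ∘ (false ∷_)) u) (count-translate (P ∘ (true ∷_)) u)
count-translate {suc n} P (true ∷ u)  =
  trans (+-comm (count n (λ v → P (true ∷ (v ⊕ u)))) (count n (λ v → P (false ∷ (v ⊕ u)))))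
        (cong₂ _+_ (count-translate (P ∘ (false ∷_)) u) (count-translate (P ∘ (true ∷_)) u))

search : (P : F₂^ n → Bool) → (∃ λ v → P v ≡ true) ⊎ (∀ v → P v ≡ false)
search {zero} P with P [] in P[]
... | true  = inj₁ ([] , P[])
... | false = inj₂ λ { [] → P[] }
search {suc n} P with search (P ∘ (false ∷_)) | search (P ∘ (true ∷_))
... | inj₁ (v , Pv) | _             = inj₁ (false ∷ v , Pv)
... | inj₂ _        | inj₁ (v , Pv) = inj₁ (true ∷ v , Pv)
... | inj₂ P₀≡false | inj₂ P₁≡false = inj₂ λ { (false ∷ v) → P₀≡false v ; (true ∷ v) → P₁≡false v }

-- Linear sets are powerful

full-linear : Linear (full {n})
full-linear = refl , λ _ _ _ _ → refl

∩-linear : {S T : VSet n} → Linear S → Linear T → Linear (S ∩ T)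
∩-linear {S = S} {T} (S0 , S⊕) (T0 , T⊕) rewrite S0 = T0 , closed
  where
  closed : ∀ u v → (S ∩ T) u ≡ true → (S ∩ T) v ≡ true → (S ∩ T) (u ⊕ v) ≡ true
  closed u v S∩Tu S∩Tv with ∩-true S T u S∩Tu | ∩-true S T v S∩Tv
  ... | Su , Tu | Sv , Tv rewrite S⊕ u v Su Sv = T⊕ u v Tu Tv

zeroOn-linear : (X : Subset n) → Linear (zeroOn X)
zeroOn-linear X = zeroOn-0ⁿ X , zeroOn-⊕ X
  where
  zeroOn-0ⁿ : (X : Subset n) → zeroOn X 0ⁿ ≡ true
  zeroOn-0ⁿ []          = refl
  zeroOn-0ⁿ (false ∷ X) = zeroOn-0ⁿ X
  zeroOn-0ⁿ (true ∷ X)  = zeroOn-0ⁿ X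
  zeroOn-⊕ : (X : Subset n) (u v : F₂^ n) → zeroOn X u ≡ true → zeroOn X v ≡ true → zeroOn X (u ⊕ v) ≡ true
  zeroOn-⊕ []          []          []          _  _  = refl
  zeroOn-⊕ (false ∷ X) (_ ∷ u)     (_ ∷ v)     Xu Xv = zeroOn-⊕ X u v Xu Xv
  zeroOn-⊕ (true ∷ X)  (false ∷ u) (false ∷ v) Xu Xv = zeroOn-⊕ X u v Xu Xv

tail₀-linear : {L : VSet (suc n)} → Linear L → Linear (L ∘ (false ∷_))
tail₀-linear (L0 , L⊕) = L0 , λ u v → L⊕ (false ∷ u) (false ∷ v)

linear-translate : {L : VSet n} → Linear L → ∀ {a} → L a ≡ true → ∀ x → L (x ⊕ a) ≡ L x
linear-translate {L = L} (_ , L⊕) {a} La x = ⇔→≡ (mk⇔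
  (λ Lx⊕a → subst (λ y → L y ≡ true) (⊕-cancelʳ x a) (L⊕ (x ⊕ a) a Lx⊕a La))
  (λ Lx → L⊕ x a Lx La))

linear⇒count-IsPowerOf2 : {S : VSet n} → Linear S → IsPowerOf2 (count n S)
linear⇒count-IsPowerOf2 {zero} (S0 , _) rewrite S0 = 0 , refl
linear⇒count-IsPowerOf2 {suc n} {S} lin
  with linear⇒count-IsPowerOf2 (tail₀-linear lin) | search (S ∘ (true ∷_))
... | k , #S₀≡2^k | inj₂ S₁≡false =
  k , trans (cong (count n (S ∘ (false ∷_)) +_) (count-empty _ S₁≡false)) (trans (+-identityʳ _) #S₀≡2^k)
... | k , #S₀≡2^k | inj₁ (u , S₁u) = suc k , (begin
  count n S₀ + count n S₁  ≡⟨ cong (count n S₀ +_) #S₁≡#S₀ ⟩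
  count n S₀ + count n S₀  ≡⟨ cong₂ _+_ #S₀≡2^k #S₀≡2^k ⟩
  2 ^ k + 2 ^ k            ≡⟨ cong (2 ^ k +_) (+-identityʳ (2 ^ k)) ⟨
  2 ^ suc k                ∎)
  where
  open ≡-Reasoning
  S₀ S₁ : VSet n
  S₀ = S ∘ (false ∷_)
  S₁ = S ∘ (true ∷_)
  #S₁≡#S₀ : count n S₁ ≡ count n S₀
  #S₁≡#S₀ = trans (count-cong (λ v → sym (linear-translate lin S₁u (true ∷ v)))) (count-translate S₀ u)

linear⇒powerful : {S : VSet n} → Linear S → Powerful S
linear⇒powerful lin X = linear⇒count-IsPowerOf2 (∩-linear lin (zeroOn-linear X))

-- Stacking a set on a superset

stack : VSet n → VSet n → VSet (suc n)
stack A B (false ∷ v) = A v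
stack A B (true ∷ v)  = (B ∖ A) v

stack-powerful : {A B : VSet n} → A ⊆ B → Powerful A → Powerful B → Powerful (stack A B)
stack-powerful {n} {A} {B} A⊆B powA powB (true ∷ X) with powA X
... | k , #A∩Z≡2^k = k , (begin
  count n (A ∩ zeroOn X) + count n (λ v → if stack A B (true ∷ v) then false else false)
    ≡⟨ cong (count n (A ∩ zeroOn X) +_) (count-empty _ (λ v → if-eta (stack A B (true ∷ v)))) ⟩
  count n (A ∩ zeroOn X) + 0   ≡⟨ +-identityʳ _ ⟩
  count n (A ∩ zeroOn X)       ≡⟨ #A∩Z≡2^k ⟩
  2 ^ k                        ∎)
  where open ≡-Reasoning
stack-powerful {n} {A} {B} A⊆B powA powB (false ∷ X) with powB X
... | k , #B∩Z≡2^k = k , (begin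
  count n (A ∩ Z) + count n ((B ∖ A) ∩ Z)   ≡⟨ cong₂ _+_ (count-cong A∩B∩Z≗A∩Z) (count-cong B∩Z∖A≗[B∖A]∩Z) ⟨
  count n (A ∩ B ∩ Z) + count n ((B ∩ Z) ∖ A) ≡⟨ count-split (B ∩ Z) A ⟨
  count n (B ∩ Z)                           ≡⟨ #B∩Z≡2^k ⟩
  2 ^ k                                     ∎)
  where
  open ≡-Reasoning
  Z = zeroOn X
  A∩B∩Z≗A∩Z : A ∩ B ∩ Z ≗ A ∩ Z
  A∩B∩Z≗A∩Z v with A v in Av
  ... | true  rewrite A⊆B v Av = refl
  ... | false = refl
  B∩Z∖A≗[B∖A]∩Z : (B ∩ Z) ∖ A ≗ (B ∖ A) ∩ Z
  B∩Z∖A≗[B∖A]∩Z v with A v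
  ... | true  = refl
  ... | false = refl

stack-injective : {A B A' B' : VSet n} → A ⊆ B → A' ⊆ B' → stack A B ≗ stack A' B' → A ≗ A' × B ≗ B'
stack-injective {A = A} {B} {A'} {B'} A⊆B A'⊆B' eq = A≗A' , B≗B'
  where
  A≗A' : A ≗ A'
  A≗A' v = eq (false ∷ v)
  B≗B' : B ≗ B'
  B≗B' v with A v in Av | A' v in A'v | eq (true ∷ v)
  ... | true  | true  | _    = trans (A⊆B v Av) (sym (A'⊆B' v A'v))
  ... | false | false | B≡B' = B≡B'
  ... | true  | false | _    with () ← trans (sym Av) (trans (A≗A' v) A'v)
  ... | false | true  | _    with () ← trans (sym Av) (trans (A≗A' v) A'v)

-- Graphs of linear maps

infixl 7 _·_
_·_ : F₂^ n → F₂^ n → Bool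
[]      · []      = false
(a ∷ f) · (b ∷ s) = (a ∧ b) xor (f · s)

·-⊕ : (f s s' : F₂^ n) → f · (s ⊕ s') ≡ (f · s) xor (f · s')
·-⊕ []      []      []        = refl
·-⊕ (a ∷ f) (b ∷ s) (b' ∷ s') =
  trans (cong₂ _xor_ (∧-distribˡ-xor a b b') (·-⊕ f s s')) (xor-interchange (a ∧ b) (a ∧ b') (f · s) (f · s'))

·-0ⁿ : (f : F₂^ n) → f · 0ⁿ ≡ false
·-0ⁿ []      = refl
·-0ⁿ (a ∷ f) = cong₂ _xor_ (∧-zeroʳ a) (·-0ⁿ f)

·-injective : {f f' : F₂^ n} → (f ·_) ≗ (f' ·_) → f ≡ f'
·-injective {f = []}    {[]}      _        = refl
·-injective {f = a ∷ f} {a' ∷ f'} f·≗f'· = cong₂ _∷_ a≡a' (·-injective (λ s → tail-eq s))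
  where
  unit-value : ∀ a (f : F₂^ n) → (a ∧ true) xor (f · 0ⁿ) ≡ a
  unit-value a f = trans (cong₂ _xor_ (∧-identityʳ a) (·-0ⁿ f)) (xor-identityʳ a)
  a≡a' : a ≡ a'
  a≡a' = trans (sym (unit-value a f)) (trans (f·≗f'· (true ∷ 0ⁿ)) (unit-value a' f'))
  tail-eq : ∀ s → f · s ≡ f' · s
  tail-eq s = trans (cong (_xor (f · s)) (sym (∧-zeroʳ a)))
                    (trans (f·≗f'· (false ∷ s)) (cong (_xor (f' · s)) (∧-zeroʳ a')))

graphPoint : Vec (F₂^ m) c → F₂^ m → F₂^ (c + m)
graphPoint []      s = s
graphPoint (f ∷ F) s = f · s ∷ graphPoint F s

drop-graphPoint : (F : Vec (F₂^ m) c) (s : F₂^ m) → drop c (graphPoint F s) ≡ s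
drop-graphPoint []      s = refl
drop-graphPoint (f ∷ F) s = drop-graphPoint F s

graphPoint-⊕ : (F : Vec (F₂^ m) c) (s s' : F₂^ m) → graphPoint F s ⊕ graphPoint F s' ≡ graphPoint F (s ⊕ s')
graphPoint-⊕ []      s s' = refl
graphPoint-⊕ (f ∷ F) s s' = cong₂ _∷_ (sym (·-⊕ f s s')) (graphPoint-⊕ F s s')

graphPoint-0ⁿ : (F : Vec (F₂^ m) c) → graphPoint F 0ⁿ ≡ 0ⁿ
graphPoint-0ⁿ []      = refl
graphPoint-0ⁿ (f ∷ F) = cong₂ _∷_ (·-0ⁿ f) (graphPoint-0ⁿ F)

graphPoint-injective : {F F' : Vec (F₂^ m) c} → graphPoint F ≗ graphPoint F' → F ≡ F'
graphPoint-injective {F = []}    {[]}      _   = refl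
graphPoint-injective {F = f ∷ F} {f' ∷ F'} F≗F' =
  cong₂ _∷_ (·-injective (∷-injectiveˡ ∘ F≗F')) (graphPoint-injective (∷-injectiveʳ ∘ F≗F'))

graph : Vec (F₂^ m) c → VSet m → VSet (c + m)
graph {c = c} F Q w = if does (w ≟ᵛ graphPoint F (drop c w)) then Q (drop c w) else false

graph-graphPoint : (F : Vec (F₂^ m) c) (Q : VSet m) (s : F₂^ m) → graph F Q (graphPoint F s) ≡ Q s
graph-graphPoint {c = c} F Q s
  rewrite drop-graphPoint F s | dec-true (graphPoint F s ≟ᵛ graphPoint F s) refl = refl

graph-member : (F : Vec (F₂^ m) c) (Q : VSet m) (w : F₂^ (c + m)) → graph F Q w ≡ true →
               w ≡ graphPoint F (drop c w) × Q (drop c w) ≡ true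
graph-member {c = c} F Q w Fw with w ≟ᵛ graphPoint F (drop c w)
... | yes w≡Fs = w≡Fs , Fw

graph-∋ : (F : Vec (F₂^ m) c) {Q : VSet m} {s : F₂^ m} {w : F₂^ (c + m)} →
          w ≡ graphPoint F s → Q s ≡ true → graph F Q w ≡ true
graph-∋ F {Q} {s} refl Qs = trans (graph-graphPoint F Q s) Qs

graph-linear : (F : Vec (F₂^ m) c) {Q : VSet m} → Linear Q → Linear (graph F Q)
graph-linear {c = c} F {Q} (Q0 , Q⊕) = graph-∋ F {Q} (sym (graphPoint-0ⁿ F)) Q0 , closed
  where
  closed : ∀ u v → graph F Q u ≡ true → graph F Q v ≡ true → graph F Q (u ⊕ v) ≡ true
  closed u v Fu Fv with graph-member F Q u Fu | graph-member F Q v Fv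
  ... | u≡ , Qu | v≡ , Qv =
    graph-∋ F {Q} (trans (cong₂ _⊕_ u≡ v≡) (graphPoint-⊕ F (drop c u) (drop c v))) (Q⊕ _ _ Qu Qv)

graph-mono : (F : Vec (F₂^ m) c) {Q Q' : VSet m} → Q ⊆ Q' → graph F Q ⊆ graph F Q'
graph-mono {c = c} F {Q} {Q'} Q⊆Q' w Fw with graph-member F Q w Fw
... | w≡ , Qs = graph-∋ F {Q'} w≡ (Q⊆Q' (drop c w) Qs)

graph-full-injective : {F F' : Vec (F₂^ m) c} → graph F full ≗ graph F' full → F ≡ F'
graph-full-injective {F = F} {F'} F≗F' = graphPoint-injective λ s →
  let F'∋Fs = trans (sym (F≗F' (graphPoint F s))) (graph-graphPoint F full s) in
  trans (proj₁ (graph-member F' full (graphPoint F s) F'∋Fs)) (cong (graphPoint F') (drop-graphPoint F s))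

graph-injectiveʳ : (F : Vec (F₂^ m) c) {Q Q' : VSet m} → graph F Q ≗ graph F Q' → Q ≗ Q'
graph-injectiveʳ F {Q} {Q'} FQ≗FQ' s =
  trans (sym (graph-graphPoint F Q s)) (trans (FQ≗FQ' (graphPoint F s)) (graph-graphPoint F Q' s))

-- Many powerful sets

nestedGraph-⊆ : (F : Vec (F₂^ (b + a)) c) (G : Vec (F₂^ a) b) → graph F (graph G full) ⊆ graph F full
nestedGraph-⊆ F G = graph-mono F {graph G full} {full} (λ _ _ → refl)

nestedGraphs : Vec (F₂^ (b + a)) c → Vec (F₂^ a) b → VSet (suc (c + (b + a)))
nestedGraphs F G = stack (graph F (graph G full)) (graph F full)

nestedGraphs-powerful : (F : Vec (F₂^ (b + a)) c) (G : Vec (F₂^ a) b) → Powerful (nestedGraphs F G)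
nestedGraphs-powerful F G = stack-powerful (nestedGraph-⊆ F G)
  (linear⇒powerful (graph-linear F (graph-linear G full-linear)))
  (linear⇒powerful (graph-linear F full-linear))

nestedGraphs-injective : {F F' : Vec (F₂^ (b + a)) c} {G G' : Vec (F₂^ a) b} →
                         nestedGraphs F G ≗ nestedGraphs F' G' → F ≡ F' × G ≡ G'
nestedGraphs-injective {F = F} {F'} {G} {G'} eq
  with stack-injective (nestedGraph-⊆ F G) (nestedGraph-⊆ F' G') eq
... | A≗A' , B≗B' with graph-full-injective {F = F} {F'} B≗B'
... | refl = refl , graph-full-injective (graph-injectiveʳ F A≗A')

funToFin-injective : {f g : Fin m → Fin n} → funToFin f ≡ funToFin g → f ≗ g
funToFin-injective {f = f} {g} eq x =
  trans (sym (finToFun-funToFin f x)) (trans (cong (λ k → finToFun k x) eq) (finToFun-funToFin g x))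

distinct-family≤classes*n^n : {Q : {n : ℕ} → VSet n → Set} {P M : ℕ} → NumIsoClasses Q n P →
  (S : Fin M → VSet n) → (∀ i → Q (S i)) → Injective _≡_ _≗_ S → M ≤ P * n ^ n
distinct-family≤classes*n^n {n} {P = P} {M} (rep , _ , _ , classify) S QS S-injective =
  injective⇒≤ code-injective
  where
  class : Fin M → Fin P
  class i = proj₁ (classify (S i) (QS i))
  perm : Fin M → Permutation′ n
  perm i = proj₁ (proj₂ (classify (S i) (QS i)))
  S≡rep∘perm : ∀ i v → rep (class i) (permute (perm i) v) ≡ S i v
  S≡rep∘perm i = proj₂ (proj₂ (classify (S i) (QS i)))
  code : Fin M → Fin (P * n ^ n)
  code i = combine (class i) (funToFin (perm i ⟨$⟩ʳ_))
  same-class-and-perm⇒≗ : ∀ {i j} → class i ≡ class j → (perm i ⟨$⟩ʳ_) ≗ (perm j ⟨$⟩ʳ_) → S i ≗ S j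
  same-class-and-perm⇒≗ {i} {j} classᵢ≡classⱼ permᵢ≗permⱼ v = begin
    S i v                                ≡⟨ S≡rep∘perm i v ⟨
    rep (class i) (permute (perm i) v)   ≡⟨ cong₂ rep classᵢ≡classⱼ permuteᵢ≡permuteⱼ ⟩
    rep (class j) (permute (perm j) v)   ≡⟨ S≡rep∘perm j v ⟩
    S j v                                ∎
    where
    open ≡-Reasoning
    permuteᵢ≡permuteⱼ = tabulate-cong (cong (lookup v) ∘ permᵢ≗permⱼ)
  code-injective : Injective _≡_ _≡_ code
  code-injective {i} {j} eq =
    let classᵢ≡classⱼ , permᵢ≡permⱼ = combine-injective (class i) _ (class j) _ eq in
    S-injective (same-class-and-perm⇒≗ classᵢ≡classⱼ (funToFin-injective permᵢ≡permⱼ))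

remQuot-injective : {k : ℕ} (l : ℕ) {i j : Fin (k * l)} → remQuot {k} l i ≡ remQuot l j → i ≡ j
remQuot-injective {k} l {i} {j} eq =
  trans (sym (combine-remQuot {k} l i)) (trans (cong (uncurry combine) eq) (combine-remQuot {k} l j))

decodeVec : {A : Set} {k : ℕ} (r : ℕ) → (Fin k → A) → Fin (k ^ r) → Vec A r
decodeVec         zero    d _ = []
decodeVec {k = k} (suc r) d i = let x , y = remQuot {k} (k ^ r) i in d x ∷ decodeVec r d y

decodeVec-injective : {A : Set} {k : ℕ} (r : ℕ) {d : Fin k → A} →
                      Injective _≡_ _≡_ d → Injective _≡_ _≡_ (decodeVec r d)
decodeVec-injective         zero    _          {zero} {zero} _  = refl
decodeVec-injective {k = k} (suc r) d-injective eq = remQuot-injective (k ^ r)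
  (cong₂ _,_ (d-injective (∷-injectiveˡ eq)) (decodeVec-injective r d-injective (∷-injectiveʳ eq)))

bit : Fin 2 ↣ Bool
bit = ↔⇒↣ 2↔Bool

decodeMatrix : Fin ((2 ^ m) ^ c) → Vec (F₂^ m) c
decodeMatrix {m} {c} = decodeVec c (decodeVec m (Injection.to bit))

decodeMatrix-injective : Injective _≡_ _≡_ (decodeMatrix {m} {c})
decodeMatrix-injective {m} {c} = decodeVec-injective c (decodeVec-injective m (Injection.injective bit))

powerful-classes-lower-bound : ∀ {a b c n P} → NumIsoClasses Powerful n P → n ≡ suc (c + (b + a)) →
                               2 ^ ((b + a) * c + a * b) ≤ P * n ^ n
powerful-classes-lower-bound {a} {b} {c} {n} {P} classes refl =
  subst (_≤ P * n ^ n) #family≡2^ (distinct-family≤classes*n^n {Q = Powerful} classes family family-powerful family-injective)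
  where
  K₁ = (2 ^ (b + a)) ^ c
  K₂ = (2 ^ a) ^ b
  matrices : Fin (K₁ * K₂) → Vec (F₂^ (b + a)) c × Vec (F₂^ a) b
  matrices i = let x , y = remQuot {K₁} K₂ i in decodeMatrix x , decodeMatrix y
  family : Fin (K₁ * K₂) → VSet (suc (c + (b + a)))
  family i = nestedGraphs (proj₁ (matrices i)) (proj₂ (matrices i))
  family-powerful : ∀ i → Powerful (family i)
  family-powerful i = nestedGraphs-powerful (proj₁ (matrices i)) (proj₂ (matrices i))
  family-injective : Injective _≡_ _≗_ family
  family-injective eq = let F≡F' , G≡G' = nestedGraphs-injective {b = b} {a = a} {c = c} eq in
    remQuot-injective K₂ (cong₂ _,_ (decodeMatrix-injective F≡F') (decodeMatrix-injective G≡G'))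
  #family≡2^ : K₁ * K₂ ≡ 2 ^ ((b + a) * c + a * b)
  #family≡2^ = trans (cong₂ _*_ (^-*-assoc 2 (b + a) c) (^-*-assoc 2 a b))
                     (sym (^-distribˡ-+-* 2 ((b + a) * c) (a * b)))

2^-split : ∀ {x} y z → x ≡ y + z → 2 ^ x ≡ 2 ^ y * 2 ^ z
2^-split y z refl = ^-distribˡ-+-* 2 y z

n<2^n : ∀ n → n < 2 ^ n
n<2^n zero    = s≤s z≤n
n<2^n (suc n) = subst (suc (suc n) ≤_) (cong (2 ^ n +_) (sym (+-identityʳ (2 ^ n))))
                      (+-mono-≤ (m^n>0 2 n) (n<2^n n))

2xy≤x²+y² : ∀ x y → 2 * (x * y) ≤ x * x + y * y
2xy≤x²+y² zero    y       = z≤n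
2xy≤x²+y² (suc x) zero    = subst (_≤ suc x * suc x + 0) (cong (2 *_) (sym (*-zeroʳ (suc x)))) z≤n
2xy≤x²+y² (suc x) (suc y) =
  subst₂ _≤_ (sym (lhs x y)) (sym (rhs x y)) (+-monoˡ-≤ (2 + 2 * x + 2 * y) (2xy≤x²+y² x y))
  where
  lhs : ∀ x y → 2 * ((1 + x) * (1 + y)) ≡ 2 * (x * y) + (2 + 2 * x + 2 * y)
  lhs = solve-∀
  rhs : ∀ x y → (1 + x) * (1 + x) + (1 + y) * (1 + y) ≡ x * x + y * y + (2 + 2 * x + 2 * y)
  rhs = solve-∀

m<n+m/n*n : ∀ x k .{{_ : NonZero k}} → x < k + x / k * k
m<n+m/n*n x k = subst (_< k + x / k * k) (sym (m≡m%n+[m/n]*n x k)) (+-monoˡ-< (x / k * k) (m%n<n x k))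

dn≤d²+⌊n²/4⌋ : ∀ d n → d * n ≤ d * d + n * n / 4
dn≤d²+⌊n²/4⌋ d n = m<1+n⇒m≤n (*-cancelˡ-< 4 (d * n) (suc (d * d + q)) (begin-strict
  4 * (d * n)              ≡⟨ four-dn d n ⟩
  2 * ((2 * d) * n)        ≤⟨ 2xy≤x²+y² (2 * d) n ⟩
  2 * d * (2 * d) + n * n  <⟨ +-monoʳ-< (2 * d * (2 * d)) (m<n+m/n*n (n * n) 4) ⟩
  2 * d * (2 * d) + (4 + q * 4) ≡⟨ four-suc d q ⟩
  4 * suc (d * d + q)      ∎))
  where
  open ≤-Reasoning
  q = n * n / 4
  four-dn : ∀ d n → 4 * (d * n) ≡ 2 * ((2 * d) * n)
  four-dn = solve-∀
  four-suc : ∀ d q → 2 * d * (2 * d) + (4 + q * 4) ≡ 4 * (1 + (d * d + q))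
  four-suc = solve-∀

-- Few linear sets

-- Reduced echelon forms, read from the first coordinate. Under 'nonPivot' every vector of the
-- subspace vanishes there; under 'pivot e g' the subspace is ⟦ e ⟧ together with the pivot row
-- (1 , embed e g), whose entries are zero at the pivots of e and given by g at its free coordinates.
mutual
  data Echelon : ℕ → ℕ → Set where
    empty    : Echelon 0 0
    nonPivot : Echelon n d → Echelon (suc n) d
    pivot    : (e : Echelon n d) → Free e → Echelon (suc n) (suc d)

  Free : Echelon n d → Set
  Free empty        = ⊤
  Free (nonPivot e) = Bool × Free e
  Free (pivot e _)  = Free e

embed : (e : Echelon n d) → Free e → F₂^ n
embed empty        _       = []
embed (nonPivot e) (b , f) = b ∷ embed e f
embed (pivot e _)  f       = false ∷ embed e f

⟦_⟧ : Echelon n d → VSet n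
⟦ empty      ⟧ []      = true
⟦ nonPivot e ⟧ (b ∷ v) = if b then false else ⟦ e ⟧ v
⟦ pivot e g  ⟧ (b ∷ v) = if b then ⟦ e ⟧ (v ⊕ embed e g) else ⟦ e ⟧ v

reduce : (e : Echelon n d) (u : F₂^ n) → Σ (Free e) λ f → ⟦ e ⟧ (embed e f ⊕ u) ≡ true
reduce empty        []          = tt , refl
reduce (nonPivot e) (b ∷ u)     =
  let f , ⟦e⟧f⊕u = reduce e u in
  (b , f) , subst (λ x → (if x then false else ⟦ e ⟧ (embed e f ⊕ u)) ≡ true) (sym (xor-same b)) ⟦e⟧f⊕u
reduce (pivot e g)  (false ∷ u) = reduce e u
reduce (pivot e g)  (true ∷ u)  =
  let f , ⟦e⟧f⊕u⊕g = reduce e (u ⊕ embed e g) in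
  f , subst (λ x → ⟦ e ⟧ x ≡ true) (sym (⊕-assoc (embed e f) u (embed e g))) ⟦e⟧f⊕u⊕g

echelonForm : {L : VSet n} → Linear L → Σ ℕ λ d → Σ (Echelon n d) λ e → ⟦ e ⟧ ≗ L
echelonForm {zero}          (L0 , _) = 0 , empty , λ { [] → sym L0 }
echelonForm {suc n} {L} lin with echelonForm (tail₀-linear lin) | search (L ∘ (true ∷_))
... | d , e , e≗L₀ | inj₂ L₁≡false =
  d , nonPivot e , λ { (false ∷ v) → e≗L₀ v ; (true ∷ v) → sym (L₁≡false v) }
... | d , e , e≗L₀ | inj₁ (u , L₁u) =
  suc d , pivot e f , λ { (false ∷ v) → e≗L₀ v
                        ; (true ∷ v)  → trans (e≗L₀ (v ⊕ w)) (linear-translate lin L₁w (true ∷ v)) }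
  where
  f = proj₁ (reduce e u)
  w = embed e f
  L₁w : L (true ∷ w) ≡ true
  L₁w = trans (sym (linear-translate lin L₁u (true ∷ w))) (trans (sym (e≗L₀ (w ⊕ u))) (proj₂ (reduce e u)))

echelon-dim≤ : Echelon n d → d ≤ n
echelon-dim≤ empty        = z≤n
echelon-dim≤ (nonPivot e) = m≤n⇒m≤1+n (echelon-dim≤ e)
echelon-dim≤ (pivot e _)  = s≤s (echelon-dim≤ e)

length-concatMap≤ : {A B : Set} {f : A → List B} (K M : ℕ) → (∀ x → List.length (f x) * K ≤ M) →
                    (xs : List A) → List.length (List.concatMap f xs) * K ≤ List.length xs * M
length-concatMap≤ K M fx≤ []                 = z≤n
length-concatMap≤ {f = f} K M fx≤ (x ∷ xs) = begin
  List.length (f x List.++ List.concatMap f xs) * K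
    ≡⟨ cong (_* K) (length-++ (f x)) ⟩
  (List.length (f x) + List.length (List.concatMap f xs)) * K
    ≡⟨ *-distribʳ-+ K (List.length (f x)) _ ⟩
  List.length (f x) * K + List.length (List.concatMap f xs) * K
    ≤⟨ +-mono-≤ (fx≤ x) (length-concatMap≤ K M fx≤ xs) ⟩
  M + List.length xs * M ∎
  where open ≤-Reasoning

frees : (e : Echelon n d) → List (Free e)
frees empty        = tt ∷ []
frees (nonPivot e) = List.map (false ,_) (frees e) List.++ List.map (true ,_) (frees e)
frees (pivot e _)  = frees e

∈-frees : (e : Echelon n d) (f : Free e) → f ∈ frees e
∈-frees empty        tt          = here refl
∈-frees (nonPivot e) (false , f) = ∈-++⁺ˡ (∈-map⁺ (false ,_) (∈-frees e f))
∈-frees (nonPivot e) (true , f)  = ∈-++⁺ʳ (List.map (false ,_) (frees e)) (∈-map⁺ (true ,_) (∈-frees e f))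
∈-frees (pivot e _)  f           = ∈-frees e f

length-frees : (e : Echelon n d) → List.length (frees e) * 2 ^ d ≡ 2 ^ n
length-frees empty = refl
length-frees {suc n} {d} (nonPivot e) = begin
  List.length (tagged false List.++ tagged true) * 2 ^ d
    ≡⟨ cong (_* 2 ^ d) (trans (length-++ (tagged false)) (cong₂ _+_ (length-map _ (frees e)) (length-map _ (frees e)))) ⟩
  (List.length (frees e) + List.length (frees e)) * 2 ^ d  ≡⟨ double-* (List.length (frees e)) (2 ^ d) ⟩
  2 * (List.length (frees e) * 2 ^ d)                       ≡⟨ cong (2 *_) (length-frees e) ⟩
  2 * 2 ^ n                                                 ∎
  where
  open ≡-Reasoning
  tagged : Bool → List (Bool × Free e)
  tagged b = List.map (b ,_) (frees e)
  double-* : ∀ x y → (x + x) * y ≡ 2 * (x * y)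
  double-* = solve-∀
length-frees {d = suc d} (pivot e _) =
  trans (*-swap₂ (List.length (frees e)) (2 ^ d)) (cong (2 *_) (length-frees e))
  where
  *-swap₂ : ∀ x y → x * (2 * y) ≡ 2 * (x * y)
  *-swap₂ = solve-∀

mutual
  echelons : (n d : ℕ) → List (Echelon n d)
  echelons zero    zero    = empty ∷ []
  echelons zero    (suc d) = []
  echelons (suc n) zero    = List.map nonPivot (echelons n zero)
  echelons (suc n) (suc d) = List.map nonPivot (echelons n (suc d)) List.++ pivots n d

  pivots : (n d : ℕ) → List (Echelon (suc n) (suc d))
  pivots n d = List.concatMap (λ e → List.map (pivot e) (frees e)) (echelons n d)

∈-echelons : (e : Echelon n d) → e ∈ echelons n d
∈-echelons               empty        = here refl
∈-echelons {d = zero}    (nonPivot e) = ∈-map⁺ nonPivot (∈-echelons e)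
∈-echelons {d = suc d}   (nonPivot e) = ∈-++⁺ˡ (∈-map⁺ nonPivot (∈-echelons e))
∈-echelons {suc n} {suc d} (pivot e g)  = ∈-++⁺ʳ (List.map nonPivot (echelons n (suc d)))
  (∈-concat⁺′ (∈-map⁺ (pivot e) (∈-frees e g)) (∈-map⁺ (λ e → List.map (pivot e) (frees e)) (∈-echelons e)))

#echelons : ℕ → ℕ → ℕ
#echelons n d = List.length (echelons n d)

length-pivots : ∀ n d → #echelons n d * 2 ^ (d * d) ≤ 2 ^ (n + d * n) →
                List.length (pivots n d) * 2 ^ (suc d * suc d) ≤ 2 ^ (n + suc d * suc n)
length-pivots n d #echelons-bound = begin
  #pivots * 2 ^ (suc d * suc d)                          ≡⟨ cong (#pivots *_) (2^-split d (d * d + suc d) (square-suc d)) ⟩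
  #pivots * (2 ^ d * 2 ^ (d * d + suc d))                ≡⟨ *-assoc #pivots _ _ ⟨
  #pivots * 2 ^ d * 2 ^ (d * d + suc d)                  ≤⟨ *-monoˡ-≤ _ #pivots≤ ⟩
  #echelons n d * 2 ^ n * 2 ^ (d * d + suc d)            ≡⟨ cong (#echelons n d * 2 ^ n *_) (2^-split (d * d) (suc d) refl) ⟩
  #echelons n d * 2 ^ n * (2 ^ (d * d) * 2 ^ suc d)      ≡⟨ *-interchange (#echelons n d) (2 ^ n) (2 ^ (d * d)) (2 ^ suc d) ⟩
  #echelons n d * 2 ^ (d * d) * (2 ^ n * 2 ^ suc d)      ≤⟨ *-monoˡ-≤ _ #echelons-bound ⟩
  2 ^ (n + d * n) * (2 ^ n * 2 ^ suc d)                  ≡⟨ cong (2 ^ (n + d * n) *_) (2^-split n (suc d) refl) ⟨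
  2 ^ (n + d * n) * 2 ^ (n + suc d)                      ≡⟨ 2^-split (n + d * n) (n + suc d) (exponent-split n d) ⟨
  2 ^ (n + suc d * suc n)                                ∎
  where
  open ≤-Reasoning
  #pivots = List.length (pivots n d)
  #pivots≤ : #pivots * 2 ^ d ≤ #echelons n d * 2 ^ n
  #pivots≤ = length-concatMap≤ (2 ^ d) (2 ^ n)
    (λ e → ≤-reflexive (trans (cong (_* 2 ^ d) (length-map (pivot e) (frees e))) (length-frees e)))
    (echelons n d)
  square-suc : ∀ d → suc d * suc d ≡ d + (d * d + suc d)
  square-suc = solve-∀
  exponent-split : ∀ n d → n + suc d * suc n ≡ (n + d * n) + (n + suc d)
  exponent-split = solve-∀

-- That is, #echelons n d ≤ 2^(n + d(n − d)), stated without truncated subtraction.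
length-echelons : ∀ n d → #echelons n d * 2 ^ (d * d) ≤ 2 ^ (n + d * n)
length-echelons zero    zero    = ≤-refl
length-echelons zero    (suc d) = z≤n
length-echelons (suc n) zero    = begin
  List.length (List.map nonPivot (echelons n 0)) * 1  ≡⟨ cong (_* 1) (length-map nonPivot (echelons n 0)) ⟩
  #echelons n 0 * 1                                   ≤⟨ length-echelons n 0 ⟩
  2 ^ (n + 0)                                         ≤⟨ ^-monoʳ-≤ 2 (n≤1+n (n + 0)) ⟩
  2 ^ (suc n + 0)                                     ∎
  where open ≤-Reasoning
length-echelons (suc n) (suc d) = begin
  List.length (List.map nonPivot (echelons n (suc d)) List.++ pivots n d) * 2 ^ (suc d * suc d)
    ≡⟨ cong (_* 2 ^ (suc d * suc d)) (trans (length-++ (List.map nonPivot (echelons n (suc d))))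
                                            (cong (_+ #pivots) (length-map nonPivot (echelons n (suc d))))) ⟩
  (#echelons n (suc d) + #pivots) * 2 ^ (suc d * suc d)
    ≡⟨ *-distribʳ-+ (2 ^ (suc d * suc d)) (#echelons n (suc d)) #pivots ⟩
  #echelons n (suc d) * 2 ^ (suc d * suc d) + #pivots * 2 ^ (suc d * suc d)
    ≤⟨ +-mono-≤ nonPivot-bound (length-pivots n d (length-echelons n d)) ⟩
  2 ^ H + 2 ^ H                 ≡⟨ cong (2 ^ H +_) (+-identityʳ (2 ^ H)) ⟨
  2 ^ (suc n + suc d * suc n)   ∎
  where
  open ≤-Reasoning
  H = n + suc d * suc n
  #pivots = List.length (pivots n d)
  nonPivot-bound : #echelons n (suc d) * 2 ^ (suc d * suc d) ≤ 2 ^ H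
  nonPivot-bound = ≤-trans (length-echelons n (suc d)) (^-monoʳ-≤ 2 (+-monoʳ-≤ n (*-monoʳ-≤ (suc d) (n≤1+n n))))

length-echelons≤ : ∀ n d → #echelons n d ≤ 2 ^ (n + n * n / 4)
length-echelons≤ n d = *-cancelʳ-≤ _ _ (2 ^ (d * d)) {{m^n≢0 2 (d * d)}} (begin
  #echelons n d * 2 ^ (d * d)                ≤⟨ length-echelons n d ⟩
  2 ^ (n + d * n)                            ≤⟨ ^-monoʳ-≤ 2 (+-monoʳ-≤ n (dn≤d²+⌊n²/4⌋ d n)) ⟩
  2 ^ (n + (d * d + n * n / 4))              ≡⟨ 2^-split (n + n * n / 4) (d * d) (regroup n (d * d) (n * n / 4)) ⟩
  2 ^ (n + n * n / 4) * 2 ^ (d * d)          ∎)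
  where
  open ≤-Reasoning
  regroup : ∀ x y z → x + (y + z) ≡ (x + z) + y
  regroup = solve-∀

echelonsOfDim : (n d : ℕ) → List (∃ (Echelon n))
echelonsOfDim n d = List.map (d ,_) (echelons n d)

allEchelons : (n : ℕ) → List (∃ (Echelon n))
allEchelons n = List.concatMap (echelonsOfDim n) (List.upTo (suc n))

∈-allEchelons : (e : Echelon n d) → (d , e) ∈ allEchelons n
∈-allEchelons {n} {d} e = ∈-concat⁺′ (∈-map⁺ (d ,_) (∈-echelons e))
  (∈-map⁺ (echelonsOfDim n) (∈-upTo⁺ (s≤s (echelon-dim≤ e))))

length-allEchelons : ∀ n → List.length (allEchelons n) ≤ suc n * 2 ^ (n + n * n / 4)
length-allEchelons n = begin
  List.length (allEchelons n)      ≡⟨ *-identityʳ _ ⟨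
  List.length (allEchelons n) * 1
    ≤⟨ length-concatMap≤ {f = echelonsOfDim n} 1 (2 ^ (n + n * n / 4)) length-ofDim (List.upTo (suc n)) ⟩
  List.length (List.upTo (suc n)) * 2 ^ (n + n * n / 4) ≡⟨ cong (_* 2 ^ (n + n * n / 4)) (length-upTo (suc n)) ⟩
  suc n * 2 ^ (n + n * n / 4) ∎
  where
  open ≤-Reasoning
  length-ofDim : ∀ d → List.length (echelonsOfDim n d) * 1 ≤ 2 ^ (n + n * n / 4)
  length-ofDim d = ≤-trans (≤-reflexive (trans (*-identityʳ _) (length-map _ (echelons n d))))
                           (length-echelons≤ n d)

injective∈⇒≤ : {A : Set} {xs : List A} (f : Fin m → A) → (∀ i → f i ∈ xs) → Injective _≡_ _≡_ f →
               m ≤ List.length xs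
injective∈⇒≤ {xs = xs} f f∈ f-injective = injective⇒≤ λ {i} {j} eq →
  f-injective (trans (lookup-index (f∈ i)) (trans (cong (List.lookup xs) eq) (sym (lookup-index (f∈ j)))))

distinct-linear-family-≤ : {L : ℕ} (S : Fin L → VSet n) → (∀ i → Linear (S i)) → Injective _≡_ _≗_ S →
                           L ≤ suc n * 2 ^ (n + n * n / 4)
distinct-linear-family-≤ {n} S linear S-injective =
  ≤-trans (injective∈⇒≤ form (λ i → ∈-allEchelons (proj₁ (proj₂ (echelonForm (linear i))))) form-injective)
          (length-allEchelons n)
  where
  form : _ → ∃ (Echelon n)
  form i = let d , e , _ = echelonForm (linear i) in d , e
  form-injective : Injective _≡_ _≡_ form
  form-injective {i} {j} eq = S-injective λ v →
    trans (sym (proj₂ (proj₂ (echelonForm (linear i))) v))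
          (trans (cong (λ (_ , e) → ⟦ e ⟧ v) eq) (proj₂ (proj₂ (echelonForm (linear j))) v))

≗⇒Isomorphic : {S T : VSet n} → S ≗ T → Isomorphic S T
≗⇒Isomorphic {T = T} S≗T = Permutation.id , λ v → trans (cong T (tabulate∘lookup v)) (sym (S≗T v))

linear-classes-upper-bound : {L : ℕ} → NumIsoClasses LinearPowerful n L → L ≤ suc n * 2 ^ (n + n * n / 4)
linear-classes-upper-bound (rep , linPow , nonIsomorphic , _) =
  distinct-linear-family-≤ rep (proj₂ ∘ linPow) (nonIsomorphic _ _ ∘ ≗⇒Isomorphic)

36[1+t]≤2^t : ∀ {t} → 9 ≤ t → 36 * suc t ≤ 2 ^ t
36[1+t]≤2^t {t} 9≤t with t ∸ 9 | m+[n∸m]≡n 9≤t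
... | u | refl = from9 u
  where
  from9 : ∀ u → 36 * suc (9 + u) ≤ 2 ^ (9 + u)
  from9 zero    = m≤m+n 360 152
  from9 (suc u) = begin
    36 * suc (suc (9 + u))          ≡⟨ *-distribˡ-+ 36 1 (suc (9 + u)) ⟩
    36 + 36 * suc (9 + u)           ≤⟨ +-mono-≤ (≤-trans (m≤m*n 36 (suc (9 + u))) (from9 u)) (from9 u) ⟩
    2 ^ (9 + u) + 2 ^ (9 + u)       ≡⟨ cong (2 ^ (9 + u) +_) (+-identityʳ (2 ^ (9 + u))) ⟨
    2 ^ suc (9 + u)                 ∎
    where open ≤-Reasoning

n^n≤2^[n/36*n] : ∀ {n} → 324 ≤ n → n ^ n ≤ 2 ^ (n / 36 * n)
n^n≤2^[n/36*n] {n} 324≤n = begin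
  n ^ n                ≤⟨ ^-monoˡ-≤ n n≤2^t ⟩
  (2 ^ (n / 36)) ^ n   ≡⟨ ^-*-assoc 2 (n / 36) n ⟩
  2 ^ (n / 36 * n)     ∎
  where
  open ≤-Reasoning
  n≤2^t : n ≤ 2 ^ (n / 36)
  n≤2^t = ≤-trans (<⇒≤ (subst (n <_) (*-comm (suc (n / 36)) 36) (m<n+m/n*n n 36)))
                  (36[1+t]≤2^t (/-monoˡ-≤ 36 324≤n))

22m+19+2k≤m² : ∀ {k m} → 23 + 2 * k ≤ m → 22 * m + 19 + 2 * k ≤ m * m
22m+19+2k≤m² {k} {m} 23+2k≤m = begin
  22 * m + 19 + 2 * k      ≤⟨ +-mono-≤ (+-monoʳ-≤ (22 * m) 19≤m) (m≤m*n (2 * k) m) ⟩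
  22 * m + m + 2 * k * m   ≡⟨ regroup k m ⟩
  (23 + 2 * k) * m         ≤⟨ *-monoˡ-≤ m 23+2k≤m ⟩
  m * m                    ∎
  where
  open ≤-Reasoning
  19≤m : 19 ≤ m
  19≤m = ≤-trans (m≤m+n 19 (4 + 2 * k)) 23+2k≤m
  instance
    m≢0 : NonZero m
    m≢0 = >-nonZero (≤-trans (s≤s z≤n) 19≤m)
  regroup : ∀ k m → 22 * m + m + 2 * k * m ≡ (23 + 2 * k) * m
  regroup = solve-∀

-- The exponents of ℓ(n) and of n^n grow like n²/4 and n²/36, that of the family like n²/3 > n²/4 + n²/36.
exponent-gap : ∀ {k m r n q t} → 23 + 2 * k ≤ m → n ≤ 3 * suc m → q * 4 ≤ n * n → t * 36 ≤ n →
               k + (suc n + (n + q) + t * n) ≤ (m + m) * (m + r) + m * m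
exponent-gap {k} {m} {r} {n} {q} {t} 23+2k≤m n≤3[1+m] 4q≤n² 36t≤n = *-cancelˡ-≤ 36 (begin
  36 * (k + (suc n + (n + q) + t * n))                ≡⟨ expand k n q t ⟩
  36 * k + 36 + 72 * n + 9 * (q * 4) + t * 36 * n
    ≤⟨ +-mono-≤ (+-monoʳ-≤ (36 * k + 36 + 72 * n) (*-monoʳ-≤ 9 4q≤n²)) (*-monoˡ-≤ n 36t≤n) ⟩
  36 * k + 36 + 72 * n + 9 * (n * n) + n * n
    ≤⟨ +-mono-≤ (+-mono-≤ (+-monoʳ-≤ (36 * k + 36) (*-monoʳ-≤ 72 n≤3[1+m]))
                          (*-monoʳ-≤ 9 (*-mono-≤ n≤3[1+m] n≤3[1+m])))
                (*-mono-≤ n≤3[1+m] n≤3[1+m]) ⟩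
  36 * k + 36 + 72 * N + 9 * (N * N) + N * N          ≡⟨ collect k m ⟩
  90 * (m * m) + 18 * (22 * m + 19 + 2 * k)           ≤⟨ +-monoʳ-≤ (90 * (m * m)) (*-monoʳ-≤ 18 (22m+19+2k≤m² {k} 23+2k≤m)) ⟩
  90 * (m * m) + 18 * (m * m)                         ≤⟨ m≤m+n _ (72 * (m * r)) ⟩
  90 * (m * m) + 18 * (m * m) + 72 * (m * r)          ≡⟨ factor m r ⟩
  36 * ((m + m) * (m + r) + m * m)                    ∎)
  where
  open ≤-Reasoning
  N = 3 * suc m
  expand : ∀ k n q t → 36 * (k + (1 + n + (n + q) + t * n)) ≡ 36 * k + 36 + 72 * n + 9 * (q * 4) + t * 36 * n
  expand = solve-∀
  collect : ∀ k m → 36 * k + 36 + 72 * (3 * (1 + m)) + 9 * ((3 * (1 + m)) * (3 * (1 + m))) + (3 * (1 + m)) * (3 * (1 + m))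
                    ≡ 90 * (m * m) + 18 * (22 * m + 19 + 2 * k)
  collect = solve-∀
  factor : ∀ m r → 90 * (m * m) + 18 * (m * m) + 72 * (m * r) ≡ 36 * ((m + m) * (m + r) + m * m)
  factor = solve-∀

thirds : ∀ {K n} → 3 * K < n → ∃ λ m → ∃ λ r → r < 3 × K ≤ m × n ≡ suc ((m + r) + (m + m))
thirds {K} {suc n} (s≤s 3K≤n) = n / 3 , n % 3 , m%n<n n 3 , K≤n/3 ,
  cong suc (trans (m≡m%n+[m/n]*n n 3) (regroup (n % 3) (n / 3)))
  where
  K≤n/3 : K ≤ n / 3
  K≤n/3 = subst (_≤ n / 3) (m*n/n≡m K 3) (/-monoˡ-≤ 3 (subst (_≤ n) (*-comm 3 K) 3K≤n))
  regroup : ∀ r m → r + m * 3 ≡ (m + r) + (m + m)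
  regroup = solve-∀

eventually-dominates : ∀ {k m r n} → n ≡ suc ((m + r) + (m + m)) → r < 3 → 108 + 2 * k ≤ m →
  k * (suc n * 2 ^ (n + n * n / 4)) * n ^ n < 2 ^ ((m + m) * (m + r) + m * m)
eventually-dominates {k} {m} {r} {n} refl r<3 108+2k≤m = begin-strict
  k * (suc n * 2 ^ (n + q)) * n ^ n
    ≤⟨ *-mono-≤ (*-monoʳ-≤ k (*-monoˡ-≤ (2 ^ (n + q)) (<⇒≤ (n<2^n (suc n))))) (n^n≤2^[n/36*n] 324≤n) ⟩
  k * (2 ^ suc n * 2 ^ (n + q)) * 2 ^ (t * n)   ≡⟨ *-assoc k _ _ ⟩
  k * (2 ^ suc n * 2 ^ (n + q) * 2 ^ (t * n))   ≡⟨ cong (k *_) 2^X-split ⟨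
  k * 2 ^ X                                     <⟨ *-monoˡ-< (2 ^ X) {{m^n≢0 2 X}} (n<2^n k) ⟩
  2 ^ k * 2 ^ X                                 ≡⟨ ^-distribˡ-+-* 2 k X ⟨
  2 ^ (k + X)                                   ≤⟨ ^-monoʳ-≤ 2 (exponent-gap {k} {m} {r} {n} {q} {t} 23+2k≤m n≤3[1+m]
                                                                 (m/n*n≤m (n * n) 4) (m/n*n≤m n 36)) ⟩
  2 ^ ((m + m) * (m + r) + m * m)               ∎
  where
  open ≤-Reasoning
  q = n * n / 4
  t = n / 36
  X = suc n + (n + q) + t * n
  2^X-split : 2 ^ X ≡ 2 ^ suc n * 2 ^ (n + q) * 2 ^ (t * n)
  2^X-split = trans (^-distribˡ-+-* 2 (suc n + (n + q)) (t * n))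
                    (cong (_* 2 ^ (t * n)) (^-distribˡ-+-* 2 (suc n) (n + q)))
  23+2k≤m : 23 + 2 * k ≤ m
  23+2k≤m = ≤-trans (+-monoˡ-≤ (2 * k) (m≤m+n 23 85)) 108+2k≤m
  three-m : ∀ m → 3 * m ≡ m + (m + m)
  three-m = solve-∀
  three-suc : ∀ m → 1 + (m + 2 + (m + m)) ≡ 3 * (1 + m)
  three-suc = solve-∀
  324≤n : 324 ≤ n
  324≤n = ≤-trans (*-monoʳ-≤ 3 (≤-trans (m≤m+n 108 (2 * k)) 108+2k≤m))
                  (≤-trans (≤-reflexive (three-m m)) (m≤n⇒m≤1+n (+-monoˡ-≤ (m + m) (m≤m+n m r))))
  n≤3[1+m] : n ≤ 3 * suc m
  n≤3[1+m] = ≤-trans (s≤s (+-monoˡ-≤ (m + m) (+-monoʳ-≤ m (m<1+n⇒m≤n r<3))))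
                     (≤-reflexive (three-suc m))

mainTheorem17 : (p ℓ : ℕ → ℕ)
    → (∀ n → NumIsoClasses Powerful n (p n))
    → (∀ n → NumIsoClasses LinearPowerful n (ℓ n))
    → ∀ (k : ℕ) → ∃ λ N → ∀ n → N ≤ n → k * ℓ n < p n
mainTheorem17 p ℓ powerful-classes linear-classes k = suc (3 * (108 + 2 * k)) , eventually
  where
  eventually : ∀ n → suc (3 * (108 + 2 * k)) ≤ n → k * ℓ n < p n
  eventually n N≤n =
    let m , r , r<3 , 108+2k≤m , n≡ = thirds N≤n in
    *-cancelʳ-< (n ^ n) (k * ℓ n) (p n) (begin-strict
      k * ℓ n * n ^ n
        ≤⟨ *-monoˡ-≤ (n ^ n) (*-monoʳ-≤ k (linear-classes-upper-bound (linear-classes n))) ⟩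
      k * (suc n * 2 ^ (n + n * n / 4)) * n ^ n   <⟨ eventually-dominates {k} n≡ r<3 108+2k≤m ⟩
      2 ^ ((m + m) * (m + r) + m * m)             ≤⟨ powerful-classes-lower-bound {m} {m} {m + r} (powerful-classes n) n≡ ⟩
      p n * n ^ n                                 ∎)
    where open ≤-Reasoning
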